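{- Let $G$ be a graph with $\chi'(G)=k$ and let $H$ be a $k$-dense subgraph of $G$. Let $\psi$ be a $k$-edge-coloring of $H$ and $\varphi$ a $k$-edge-coloring of $G-E(H)$ such that the colors of the edges in $\partial_G(H)$ under $\varphi$ are pairwise distinct. Then: (a) If $k\ge\Delta(G)$, there is a permutation $\pi$ of $[k]$ such that the coloring of $G$ equal to $\pi\circ\psi$ on $E(H)$ and to $\varphi$ on $E(G)\setminus E(H)$ is a proper $k$-edge-coloring of $G$. (b) For any fixed color $i\in[k]$, if $k\ge\Delta(G)+1$, there is a permutation $\pi$ of $[k]$ with $\pi(i)=i$ such that in the coloring of $G$ equal to $\pi\circ\psi$ on $E(H)$ and to $\varphi$ on $E(G)\setminus E(H)$, every color class other than $i$ is a matching, and the set of $i$-edges is a matching with the only possible exception that exactly one $i$-edge from $E(H)$ and exactly one $i$-edge from $\partial_G(H)$ share an endvertex.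
   Context: Graphs are finite, loopless, possibly with multiple edges. A $k$-edge-coloring is a proper edge coloring with palette $[k]=\{1,\dots,k\}$ (edges sharing an endvertex get different colors); $\chi'$ is the chromatic index and $\Delta(G)$ the maximum degree. A subgraph $H$ is $k$-dense if $|V(H)|$ is odd and $|E(H)|=(|V(H)|-1)k/2$. $\partial_G(H)$ is the set of edges of $G$ with exactly one endvertex in $V(H)$. An $i$-edge is an edge colored $i$. -}

module Defs where

open import Data.Nat using (ℕ; _≤_; _<_; _+_; _*_; _∸_; _⊔_; _/_)
open import Data.Fin using (Fin; _≟_)
open import Data.Fin.Subset using (Subset; _∈_; _∉_; ∣_∣)
open import Data.Fin.Subset.Properties using (_∈?_)
open import Data.Fin.Permutation using (Permutation′; _⟨$⟩ʳ_)
open import Data.List using (List; length; filter; map; foldr; allFin)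
open import Data.Product using (Σ; _×_; _,_; proj₁; proj₂; ∃)
open import Data.Sum using (_⊎_)
open import Data.Bool using (if_then_else_)
open import Relation.Nullary using (¬_; Dec)
open import Relation.Nullary.Decidable using (⌊_⌋; _⊎-dec_)
open import Relation.Binary.PropositionalEquality using (_≡_; _≢_)

record Graph : Set where
  field
    n : ℕ
    m : ℕ
    ends : Fin m → Fin n × Fin n
    loopless : ∀ e → proj₁ (ends e) ≢ proj₂ (ends e)
open Graph public

Incident : (G : Graph) → Fin (m G) → Fin (n G) → Set
Incident G e v = proj₁ (ends G e) ≡ v ⊎ proj₂ (ends G e) ≡ v

incident? : (G : Graph) → (v : Fin (n G)) → (e : Fin (m G)) → Dec (Incident G e v)
incident? G v e = (proj₁ (ends G e) ≟ v) ⊎-dec (proj₂ (ends G e) ≟ v)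

deg : (G : Graph) → Fin (n G) → ℕ
deg G v = length (filter (incident? G v) (allFin (m G)))

Δ : Graph → ℕ
Δ G = foldr _⊔_ 0 (map (deg G) (allFin (n G)))

Adjacent : (G : Graph) → Fin (m G) → Fin (m G) → Set
Adjacent G e f = e ≢ f × ∃ λ v → Incident G e v × Incident G f v

ProperColoring : (G : Graph) (k : ℕ) → (Fin (m G) → Fin k) → Set
ProperColoring G k c = ∀ e f → Adjacent G e f → c e ≢ c f

Colorable : Graph → ℕ → Set
Colorable G k = Σ (Fin (m G) → Fin k) (ProperColoring G k)

ChromaticIndex : Graph → ℕ → Set
ChromaticIndex G k = Colorable G k × (∀ j → j < k → ¬ Colorable G j)

record Subgraph (G : Graph) : Set where
  field
    VH : Subset (n G)
    EH : Subset (m G)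
    closed : ∀ e → e ∈ EH → proj₁ (ends G e) ∈ VH × proj₂ (ends G e) ∈ VH
open Subgraph public

Odd : ℕ → Set
Odd x = ∃ λ t → x ≡ 1 + 2 * t

Dense : (G : Graph) → Subgraph G → ℕ → Set
Dense G H k = Odd ∣ VH H ∣ × ∣ EH H ∣ ≡ ((∣ VH H ∣ ∸ 1) * k) / 2

InBoundary : (G : Graph) → Subgraph G → Fin (m G) → Set
InBoundary G H e =
  (proj₁ (ends G e) ∈ VH H × proj₂ (ends G e) ∉ VH H)
  ⊎ (proj₁ (ends G e) ∉ VH H × proj₂ (ends G e) ∈ VH H)

-- ψ is a proper k-edge-coloring of H (only values on E(H) matter)
ProperOnH : (G : Graph) (H : Subgraph G) (k : ℕ) → (Fin (m G) → Fin k) → Set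
ProperOnH G H k ψ = ∀ e f → e ∈ EH H → f ∈ EH H → Adjacent G e f → ψ e ≢ ψ f

-- φ is a proper k-edge-coloring of G − E(H) (only values off E(H) matter)
ProperOffH : (G : Graph) (H : Subgraph G) (k : ℕ) → (Fin (m G) → Fin k) → Set
ProperOffH G H k φ = ∀ e f → e ∉ EH H → f ∉ EH H → Adjacent G e f → φ e ≢ φ f

combine : (G : Graph) (H : Subgraph G) (k : ℕ) → Permutation′ k →
          (Fin (m G) → Fin k) → (Fin (m G) → Fin k) → Fin (m G) → Fin k
combine G H k π ψ φ e = if ⌊ e ∈? EH H ⌋ then π ⟨$⟩ʳ (ψ e) else φ e

AlmostProper : (G : Graph) (H : Subgraph G) (k : ℕ) → (Fin (m G) → Fin k) → Fin k → Set
AlmostProper G H k c i =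
  (∀ e f → Adjacent G e f → c e ≡ c f → c e ≡ i)
  × (∀ e f → Adjacent G e f → c e ≡ i → c f ≡ i →
       (e ∈ EH H × InBoundary G H f) ⊎ (f ∈ EH H × InBoundary G H e))
  × (∀ e f e′ f′ → e ∈ EH H → InBoundary G H f → e′ ∈ EH H → InBoundary G H f′ →
       Adjacent G e f → Adjacent G e′ f′ →
       c e ≡ i → c f ≡ i → c e′ ≡ i → c f′ ≡ i → e ≡ e′ × f ≡ f′)

-- Write |V(H)| = 2t + 1, so that |E(H)| = t k. A matching inside an odd set of 2t + 1 vertices has at
-- most t edges, and fewer than t if two of these vertices are unmatched. Splitting the edges of G inside
-- V(H) into the k colour classes of an optimal colouring therefore shows that they all belong to E(H),
-- and splitting E(H) into the k colour classes of ψ shows that every colour is missed by ψ at no more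
-- than one vertex of H. A boundary edge f with end v in V(H) conflicts with π ∘ ψ only if π⁻¹(φ f) is
-- used by ψ at v. The sets of colours missed at different vertices are disjoint, and at least
-- k − deg_H(v) ≥ deg_{G−E(H)}(v) colours are missed at v, so a permutation sending a colour missed at v
-- to φ f, for every boundary edge f, exists. For (b), i is removed from every missed set and the
-- boundary edge of φ-colour i is left unconstrained; the extra colour in k ≥ Δ + 1 pays for the removal.

module Submission where

open import Data.Bool using (true; false; if_then_else_)
open import Data.Empty using (⊥-elim)
open import Data.Fin using (Fin; zero; suc; _≟_)
open import Data.Fin.Permutation using (Permutation′; _⟨$⟩ʳ_; _⟨$⟩ˡ_; inverseˡ; _∘ₚ_; transpose)
import Data.Fin.Permutation as Perm
open import Data.Fin.Properties using (any?; ¬Fin0)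
import Data.Fin.Properties as Fin
open import Data.Fin.Subset using (Subset; _∈_; _∉_; ∣_∣)
open import Data.Fin.Subset.Properties using (_∈?_)
open import Data.List using (length; filter; foldr; tabulate)
open import Data.List.Properties using (map-tabulate)
open import Data.Nat using (ℕ; zero; suc; _≤_; _<_; _+_; _*_; _∸_; _/_; _⊔_; z≤n)
open import Data.Nat.DivMod using (m*n/n≡m)
open import Data.Nat.Properties hiding (_≟_)
open import Data.Product using (Σ; Σ-syntax; ∃; _×_; _,_; proj₁; proj₂; map₁)
open import Data.Sum using (_⊎_; inj₁; inj₂; map₂)
open import Data.Unit using (tt)
open import Data.Vec using ([]; _∷_)
open import Function using (_∘_; id)
open import Level using (Level; 0ℓ)
open import Relation.Binary.PropositionalEquality
  using (_≡_; _≢_; refl; sym; trans; cong; cong₂; subst; module ≡-Reasoning)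
open import Relation.Nullary using (Dec; does; yes; no; ¬_; _×-dec_; _⊎-dec_; ¬?; contradiction)
open import Relation.Nullary.Decidable using (decidable-stable)
open import Relation.Unary using (Pred; Decidable; _⊆_; U; _∩_; ∁)
open import Relation.Unary.Properties using (U?; _∩?_; ∁?)
open import Algebra.Properties.CommutativeMonoid.Sum +-0-commutativeMonoid
  using (sum; ∑-comm; ∑-distrib-+; sum-cong-≗; sum-replicate-zero)
open import Defs

private variable
  ℓ ℓ′ : Level
  N k : ℕ

-- Counting over Fin

indicator : ∀ {A : Set ℓ} → Dec A → ℕ
indicator a? = if does a? then 1 else 0

indicator-yes : ∀ {A : Set ℓ} (a? : Dec A) → A → indicator a? ≡ 1
indicator-yes (yes _) _ = refl
indicator-yes (no ¬a) a = ⊥-elim (¬a a)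

count : {P : Pred (Fin N) ℓ} → Decidable P → ℕ
count P? = sum (indicator ∘ P?)

sum-mono-≤ : {f g : Fin N → ℕ} → (∀ x → f x ≤ g x) → sum f ≤ sum g
sum-mono-≤ {zero}  f≤g = z≤n
sum-mono-≤ {suc N} f≤g = +-mono-≤ (f≤g zero) (sum-mono-≤ (f≤g ∘ suc))

sum-≤-* : (f : Fin N → ℕ) {t : ℕ} → (∀ x → f x ≤ t) → sum f ≤ N * t
sum-≤-* {zero}  f f≤t = z≤n
sum-≤-* {suc N} f f≤t = +-mono-≤ (f≤t zero) (sum-≤-* (f ∘ suc) (f≤t ∘ suc))

sum-<-* : (f : Fin N → ℕ) {t : ℕ} → (∀ x → f x ≤ t) → ∀ x₀ → f x₀ < t → sum f < N * t
sum-<-* {suc N} f f≤t zero     f₀<t = +-mono-<-≤ f₀<t (sum-≤-* (f ∘ suc) (f≤t ∘ suc))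
sum-<-* {suc N} f f≤t (suc x₀) fx<t = +-mono-≤-< (f≤t zero) (sum-<-* (f ∘ suc) (f≤t ∘ suc) x₀ fx<t)

module _ {P : Pred (Fin N) ℓ} (P? : Decidable P) where

  count-∅ : (∀ x → ¬ P x) → count P? ≡ 0
  count-∅ ¬P = trans (sum-cong-≗ zero-at) (sum-replicate-zero N)
    where
    zero-at : ∀ x → indicator (P? x) ≡ 0
    zero-at x with P? x
    ... | yes Px = contradiction Px (¬P x)
    ... | no _   = refl

  count-U : (∀ x → P x) → count P? ≡ N
  count-U allP = trans (sum-cong-≗ one-at) (sum-ones N)
    where
    one-at : ∀ x → indicator (P? x) ≡ 1
    one-at x = indicator-yes (P? x) (allP x)
    sum-ones : ∀ N → sum {N} (λ _ → 1) ≡ N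
    sum-ones zero    = refl
    sum-ones (suc N) = cong suc (sum-ones N)

  count>0⇒∃ : 0 < count P? → ∃ P
  count>0⇒∃ pos with any? P?
  ... | yes witness = witness
  ... | no  ¬∃     = contradiction (sym (count-∅ (λ x Px → ¬∃ (x , Px)))) (<⇒≢ pos)

count-≤1 : {P : Pred (Fin N) ℓ} (P? : Decidable P) → (∀ {x y} → P x → P y → x ≡ y) → count P? ≤ 1
count-≤1 {zero}  P? unique = z≤n
count-≤1 {suc N} P? unique with P? zero
... | yes P0 = ≤-reflexive (cong suc (count-∅ (P? ∘ suc) (λ x Px → zero≢suc (unique P0 Px))))
  where
  zero≢suc : ∀ {x : Fin N} → zero ≢ suc x
  zero≢suc ()
... | no _   = count-≤1 (P? ∘ suc) (λ Px Py → Fin.suc-injective (unique Px Py))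

∈⇒count>0 : {P : Pred (Fin N) ℓ} (P? : Decidable P) → ∀ {x} → P x → 0 < count P?
∈⇒count>0 P? {zero}  P0 = ≤-trans (≤-reflexive (sym (indicator-yes (P? zero) P0))) (m≤m+n _ _)
∈⇒count>0 P? {suc x} Px = <-≤-trans (∈⇒count>0 (P? ∘ suc) Px) (m≤n+m _ (indicator (P? zero)))

module _ {P : Pred (Fin N) ℓ} {Q : Pred (Fin N) ℓ′} (P? : Decidable P) (Q? : Decidable Q) where

  count-mono : P ⊆ Q → count P? ≤ count Q?
  count-mono P⊆Q = sum-mono-≤ at
    where
    at : ∀ x → indicator (P? x) ≤ indicator (Q? x)
    at x with P? x | Q? x
    ... | no _   | _      = z≤n
    ... | yes _  | yes _  = ≤-refl
    ... | yes Px | no ¬Qx = contradiction (P⊆Q Px) ¬Qx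

  count-split : count P? ≡ count (P? ∩? Q?) + count (P? ∩? ∁? Q?)
  count-split = trans (sum-cong-≗ at) (∑-distrib-+ (indicator ∘ (P? ∩? Q?)) (indicator ∘ (P? ∩? ∁? Q?)))
    where
    at : ∀ x → indicator (P? x) ≡ indicator ((P? ∩? Q?) x) + indicator ((P? ∩? ∁? Q?) x)
    at x with P? x | Q? x
    ... | no _  | _     = refl
    ... | yes _ | yes _ = refl
    ... | yes _ | no _  = refl

count-cong : {P : Pred (Fin N) ℓ} {Q : Pred (Fin N) ℓ′} (P? : Decidable P) (Q? : Decidable Q) →
             P ⊆ Q → Q ⊆ P → count P? ≡ count Q?
count-cong P? Q? P⊆Q Q⊆P = ≤-antisym (count-mono P? Q? P⊆Q) (count-mono Q? P? Q⊆P)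

count-singleton : (x : Fin N) → count (x ≟_) ≡ 1
count-singleton x =
  ≤-antisym (count-≤1 (x ≟_) (λ x≡y x≡z → trans (sym x≡y) x≡z)) (∈⇒count>0 (x ≟_) refl)

count≥2 : {P : Pred (Fin N) ℓ} (P? : Decidable P) → ∀ {x y} → P x → P y → x ≢ y → 2 ≤ count P?
count≥2 P? {x} {y} Px Py x≢y = begin
  2                                                ≤⟨ +-mono-≤ (∈⇒count>0 (P? ∩? (x ≟_)) (Px , refl))
                                                               (∈⇒count>0 (P? ∩? ∁? (x ≟_)) (Py , x≢y)) ⟩
  count (P? ∩? (x ≟_)) + count (P? ∩? ∁? (x ≟_))   ≡⟨ count-split P? (x ≟_) ⟨
  count P?                                         ∎
  where open ≤-Reasoning

count-insert : {P : Pred (Fin N) ℓ} (P? : Decidable P) {x : Fin N} → ¬ P x →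
               count (λ y → P? y ⊎-dec (y ≟ x)) ≡ 1 + count P?
count-insert {P = P} P? {x} ¬Px = begin
  count P+x?                                          ≡⟨ count-split P+x? (x ≟_) ⟩
  count (P+x? ∩? (x ≟_)) + count (P+x? ∩? ∁? (x ≟_))  ≡⟨ cong₂ _+_ (trans new (count-singleton x)) old ⟩
  1 + count P?                                        ∎
  where
  open ≡-Reasoning
  P+x? = λ y → P? y ⊎-dec (y ≟ x)
  new : count (P+x? ∩? (x ≟_)) ≡ count (x ≟_)
  new = count-cong (P+x? ∩? (x ≟_)) (x ≟_) proj₂ (λ x≡y → inj₂ (sym x≡y) , x≡y)
  in-P : ∀ {y} → (P y ⊎ y ≡ x) × x ≢ y → P y
  in-P (inj₁ Py , _)    = Py
  in-P (inj₂ y≡x , x≢y) = contradiction (sym y≡x) x≢y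
  old : count (P+x? ∩? ∁? (x ≟_)) ≡ count P?
  old = count-cong (P+x? ∩? ∁? (x ≟_)) P? in-P (λ Py → inj₁ Py , λ x≡y → ¬Px (subst P (sym x≡y) Py))

module _ {P : Pred (Fin N) ℓ} (P? : Decidable P) (f : Fin N → Fin k) where

  count-fibre : ∀ x → count (λ d → P? x ×-dec (f x ≟ d)) ≡ indicator (P? x)
  count-fibre x with P? x
  ... | yes Px = trans (count-cong (λ d → yes Px ×-dec (f x ≟ d)) (f x ≟_) proj₂ (Px ,_)) (count-singleton (f x))
  ... | no ¬Px = count-∅ (λ d → no ¬Px ×-dec (f x ≟ d)) (λ d → ¬Px ∘ proj₁)

  ∑-count-fibres : sum (λ d → count (P? ∩? (λ x → f x ≟ d))) ≡ count P?
  ∑-count-fibres = trans (∑-comm (λ d x → indicator ((P? ∩? (λ x → f x ≟ d)) x))) (sum-cong-≗ count-fibre)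

  count-image≤ : count (λ d → any? (λ x → P? x ×-dec (f x ≟ d))) ≤ count P?
  count-image≤ = begin
    count (λ d → any? (λ x → P? x ×-dec (f x ≟ d)))  ≤⟨ sum-mono-≤ image≤fibre ⟩
    sum (λ d → count (P? ∩? (λ x → f x ≟ d)))        ≡⟨ ∑-count-fibres ⟩
    count P?                                          ∎
    where
    open ≤-Reasoning
    image≤fibre : ∀ d → indicator (any? (λ x → P? x ×-dec (f x ≟ d))) ≤ count (P? ∩? (λ x → f x ≟ d))
    image≤fibre d with any? (λ x → P? x ×-dec (f x ≟ d))
    ... | yes (x , Px×fx≡d) = ∈⇒count>0 (P? ∩? (λ x → f x ≟ d)) Px×fx≡d
    ... | no _              = z≤n

-- Permutations with prescribed preimages

⟨$⟩ʳ-injective : (π : Permutation′ k) {x y : Fin k} → π ⟨$⟩ʳ x ≡ π ⟨$⟩ʳ y → x ≡ y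
⟨$⟩ʳ-injective π {x} {y} eq = trans (sym (inverseˡ π)) (trans (cong (π ⟨$⟩ˡ_) eq) (inverseˡ π))

transpose-matchˡ : (i j : Fin k) → transpose i j ⟨$⟩ʳ i ≡ j
transpose-matchˡ i j with i ≟ i
... | yes _   = refl
... | no i≢i = contradiction refl i≢i

transpose-fixes : {i j x : Fin k} → x ≢ i → x ≢ j → transpose i j ⟨$⟩ʳ x ≡ x
transpose-fixes {i = i} {j} {x} x≢i x≢j with x ≟ i
... | yes x≡i = contradiction x≡i x≢i
... | no _ with x ≟ j
...   | yes x≡j = contradiction x≡j x≢j
...   | no _    = refl

redirect : Permutation′ k → Fin k → Fin k → Permutation′ k
redirect π c y = π ∘ₚ transpose (π ⟨$⟩ʳ c) y

module _ (π : Permutation′ k) (c y : Fin k) where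

  redirect-preimage : ∀ {x} → redirect π c y ⟨$⟩ʳ x ≡ y → x ≡ c
  redirect-preimage eq = ⟨$⟩ʳ-injective π (⟨$⟩ʳ-injective (transpose (π ⟨$⟩ʳ c) y)
                           (trans eq (sym (transpose-matchˡ (π ⟨$⟩ʳ c) y))))

  redirect-preserves : ∀ {x z} → z ≢ π ⟨$⟩ʳ c → z ≢ y → redirect π c y ⟨$⟩ʳ x ≡ z → π ⟨$⟩ʳ x ≡ z
  redirect-preserves z≢πc z≢y eq =
    ⟨$⟩ʳ-injective (transpose (π ⟨$⟩ʳ c) y) (trans eq (sym (transpose-fixes z≢πc z≢y)))

  redirect-fixes : ∀ {x} → π ⟨$⟩ʳ x ≡ x → x ≢ c → x ≢ y → redirect π c y ⟨$⟩ʳ x ≡ x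
  redirect-fixes {x} πx≡x x≢c x≢y =
    trans (cong (transpose (π ⟨$⟩ʳ c) y ⟨$⟩ʳ_) πx≡x) (transpose-fixes x≢πc x≢y)
    where
    x≢πc : x ≢ π ⟨$⟩ʳ c
    x≢πc x≡πc = x≢c (⟨$⟩ʳ-injective π (trans πx≡x x≡πc))

module _ {p : ℕ} (A : Fin p → Pred (Fin k) 0ℓ) where

  Respects : ∀ {r} → Pred (Fin r) 0ℓ → (Fin r → Fin p) → (Fin r → Fin k) → Permutation′ k → Set
  Respects Active ℓ d π = ∀ {j} → Active j → ∀ c → π ⟨$⟩ʳ c ≡ d j → A (ℓ j) c

  Untouched : ∀ {r} → Pred (Fin r) 0ℓ → (Fin r → Fin p) → (Fin r → Fin k) → Fin k → Set
  Untouched Active ℓ d x = ∀ {j} → Active j → ¬ A (ℓ j) x × d j ≢ x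

module _ {p : ℕ} {A : Fin p → Pred (Fin k) 0ℓ} (A? : ∀ u → Decidable (A u)) where

  -- By disjointness only constraints labelled u can claim a colour of A u, and each claims at most one.
  unclaimed-colour :
    ∀ {r} {Active : Pred (Fin r) 0ℓ} (Active? : Decidable Active) (ℓ : Fin r → Fin p) (d : Fin r → Fin k) →
    (π : Permutation′ k) → Respects A Active ℓ d π → (u : Fin p) →
    (∀ {j c} → Active j → A (ℓ j) c → A u c → ℓ j ≡ u) →
    count (λ j → Active? j ×-dec (ℓ j ≟ u)) < count (A? u) →
    ∃ λ c → A u c × (∀ {j} → Active j → π ⟨$⟩ʳ c ≢ d j)
  unclaimed-colour {Active = Active} Active? ℓ d π respects u disjoint room =
    c , A-c , λ a πc≡dj → unclaimed (_ , (a , disjoint a (respects a c πc≡dj) A-c) , preimage πc≡dj)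
    where
    open ≤-Reasoning
    claimant? = λ j → Active? j ×-dec (ℓ j ≟ u)
    claimants = count claimant?
    claimed? : Decidable (λ c → ∃ λ j → (Active j × ℓ j ≡ u) × π ⟨$⟩ˡ d j ≡ c)
    claimed? c = any? (λ j → claimant? j ×-dec (π ⟨$⟩ˡ d j ≟ c))
    claimed≤claimants : count (A? u ∩? claimed?) ≤ claimants
    claimed≤claimants =
      ≤-trans (count-mono (A? u ∩? claimed?) claimed? proj₂) (count-image≤ claimant? (λ j → π ⟨$⟩ˡ d j))
    free : ∃ λ c → A u c × ¬ (∃ λ j → (Active j × ℓ j ≡ u) × π ⟨$⟩ˡ d j ≡ c)
    free = count>0⇒∃ (A? u ∩? ∁? claimed?) (+-cancelˡ-< claimants 0 _ (begin-strict
      claimants + 0                                           ≡⟨ +-identityʳ claimants ⟩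
      claimants                                               <⟨ room ⟩
      count (A? u)                                            ≡⟨ count-split (A? u) claimed? ⟩
      count (A? u ∩? claimed?) + count (A? u ∩? ∁? claimed?)  ≤⟨ +-monoˡ-≤ _ claimed≤claimants ⟩
      claimants + count (A? u ∩? ∁? claimed?)                 ∎))
    c = proj₁ free
    A-c = proj₁ (proj₂ free)
    unclaimed = proj₂ (proj₂ free)
    preimage : ∀ {j} → π ⟨$⟩ʳ c ≡ d j → π ⟨$⟩ˡ d j ≡ c
    preimage πc≡dj = trans (cong (π ⟨$⟩ˡ_) (sym πc≡dj)) (inverseˡ π)

  -- Hall's condition for pairwise disjoint blocks; π is built greedily, one transposition per constraint.
  respecting-permutation :
    ∀ {r} {Active : Pred (Fin r) 0ℓ} (Active? : Decidable Active) (ℓ : Fin r → Fin p) (d : Fin r → Fin k) →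
    (∀ {j j′} → Active j → Active j′ → d j ≡ d j′ → j ≡ j′) →
    (∀ {j j′ c} → Active j → Active j′ → A (ℓ j) c → A (ℓ j′) c → ℓ j ≡ ℓ j′) →
    (∀ {j} → Active j → count (λ j′ → Active? j′ ×-dec (ℓ j′ ≟ ℓ j)) ≤ count (A? (ℓ j))) →
    Σ[ π ∈ Permutation′ k ] Respects A Active ℓ d π × (∀ x → Untouched A Active ℓ d x → π ⟨$⟩ʳ x ≡ x)
  respecting-permutation {zero} Active? ℓ d d-inj disjoint room =
    Perm.id , (λ {j} → ⊥-elim (¬Fin0 j)) , λ _ _ → refl
  respecting-permutation {suc r} {Active} Active? ℓ d d-inj disjoint room
    with π , respects , fixes ← respecting-permutation (Active? ∘ suc) (ℓ ∘ suc) (d ∘ suc)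
           (λ a a′ eq → Fin.suc-injective (d-inj a a′ eq)) disjoint
           (λ {j} a → ≤-trans (m≤n+m _ (indicator (Active? zero ×-dec (ℓ zero ≟ ℓ (suc j))))) (room a))
       | Active? zero
  ... | no ¬a₀ = π , respects′ , λ x untouched → fixes x untouched
    where
    respects′ : Respects A Active ℓ d π
    respects′ {zero}  a₀ = contradiction a₀ ¬a₀
    respects′ {suc j} a  = respects a
  ... | yes a₀
    with c , A-c , unclaimed ← unclaimed-colour (Active? ∘ suc) (ℓ ∘ suc) (d ∘ suc) π respects (ℓ zero)
           (λ a A₁ A₂ → disjoint a a₀ A₁ A₂)
           (≤-trans (≤-reflexive (cong (_+ count (λ j → Active? (suc j) ×-dec (ℓ (suc j) ≟ ℓ zero)))
                                         (sym (indicator-yes (yes a₀ ×-dec (ℓ zero ≟ ℓ zero)) (a₀ , refl)))))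
                    (room a₀))
    = redirect π c (d zero) , respects′ , fixes′
    where
    respects′ : Respects A Active ℓ d (redirect π c (d zero))
    respects′ {zero}  _ c′ eq = subst (A (ℓ zero)) (sym (redirect-preimage π c (d zero) eq)) A-c
    respects′ {suc j} a c′ eq = respects a c′ (redirect-preserves π c (d zero) (unclaimed a ∘ sym) d≢d₀ eq)
      where
      d≢d₀ : d (suc j) ≢ d zero
      d≢d₀ dj≡d₀ with d-inj a a₀ dj≡d₀
      ... | ()
    fixes′ : ∀ x → Untouched A Active ℓ d x → redirect π c (d zero) ⟨$⟩ʳ x ≡ x
    fixes′ x untouched = redirect-fixes π c (d zero) (fixes x untouched)
                           (λ x≡c → proj₁ (untouched a₀) (subst (A (ℓ zero)) (sym x≡c) A-c))
                           (proj₂ (untouched a₀) ∘ sym)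

-- Degrees and matchings

∣p∣≡count-∈ : (p : Subset N) → ∣ p ∣ ≡ count (_∈? p)
∣p∣≡count-∈ []          = refl
∣p∣≡count-∈ (true ∷ p)  = cong suc (∣p∣≡count-∈ p)
∣p∣≡count-∈ (false ∷ p) = ∣p∣≡count-∈ p

length-filter-tabulate : ∀ {A : Set} {P : Pred A ℓ} (P? : Decidable P) (f : Fin N → A) →
                         length (filter P? (tabulate f)) ≡ count (P? ∘ f)
length-filter-tabulate {N = zero}  P? f = refl
length-filter-tabulate {N = suc N} P? f with P? (f zero)
... | yes _ = cong suc (length-filter-tabulate P? (f ∘ suc))
... | no _  = length-filter-tabulate P? (f ∘ suc)

≤-foldr-⊔-tabulate : (f : Fin N → ℕ) (x : Fin N) → f x ≤ foldr _⊔_ 0 (tabulate f)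
≤-foldr-⊔-tabulate f zero    = m≤m⊔n _ _
≤-foldr-⊔-tabulate f (suc x) = ≤-trans (≤-foldr-⊔-tabulate (f ∘ suc) x) (m≤n⊔m (f zero) _)

m+m≤1+2t⇒m≤t : ∀ {m t} → m + m ≤ 1 + 2 * t → m ≤ t
m+m≤1+2t⇒m≤t {m} {t} le = ≮⇒≥ λ t<m → <-irrefl refl (begin-strict
  suc (t + t)            <⟨ n<1+n _ ⟩
  suc (suc (t + t))      ≡⟨ cong suc (+-suc t t) ⟨
  suc t + suc t          ≤⟨ +-mono-≤ t<m t<m ⟩
  m + m                  ≤⟨ le ⟩
  suc (t + (t + 0))      ≡⟨ cong (λ x → suc (t + x)) (+-identityʳ t) ⟩
  suc (t + t)            ∎)
  where open ≤-Reasoning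

m+m+2≤1+2t⇒m<t : ∀ {m t} → m + m + 2 ≤ 1 + 2 * t → m < t
m+m+2≤1+2t⇒m<t {m} le = m+m≤1+2t⇒m≤t (≤-trans (≤-reflexive m+m+2≡) le)
  where
  m+m+2≡ : suc m + suc m ≡ m + m + 2
  m+m+2≡ = trans (cong suc (+-suc m m)) (+-comm 2 (m + m))

module _ (G : Graph) where

  deg≡count : ∀ v → deg G v ≡ count (incident? G v)
  deg≡count v = length-filter-tabulate (incident? G v) id

  deg≤Δ : ∀ v → deg G v ≤ Δ G
  deg≤Δ v = subst (deg G v ≤_) (cong (foldr _⊔_ 0) (sym (map-tabulate id (deg G))))
                  (≤-foldr-⊔-tabulate (deg G) v)

  count-ends : ∀ e → count (λ v → incident? G v e) ≡ 2
  count-ends e = begin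
    count (λ v → incident? G v e)        ≡⟨ count-cong (λ v → incident? G v e) a-or-b? (map₂ sym) (map₂ sym) ⟩
    count a-or-b?                        ≡⟨ count-insert (a ≟_) (loopless G e) ⟩
    1 + count (a ≟_)                     ≡⟨ cong suc (count-singleton a) ⟩
    2                                    ∎
    where
    open ≡-Reasoning
    a = proj₁ (ends G e)
    b = proj₂ (ends G e)
    a-or-b? = λ v → (a ≟ v) ⊎-dec (v ≟ b)

  handshake : {M : Pred (Fin (m G)) ℓ} (M? : Decidable M) →
              sum (λ v → count (λ e → M? e ×-dec incident? G v e)) ≡ count M? + count M?
  handshake M? = begin
    sum (λ v → count (λ e → M? e ×-dec incident? G v e))  ≡⟨ ∑-comm (λ v e → indicator (M? e ×-dec incident? G v e)) ⟩
    sum (λ e → count (λ v → M? e ×-dec incident? G v e))  ≡⟨ sum-cong-≗ ends-of ⟩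
    sum (λ e → indicator (M? e) + indicator (M? e))       ≡⟨ ∑-distrib-+ (indicator ∘ M?) (indicator ∘ M?) ⟩
    count M? + count M?                                   ∎
    where
    open ≡-Reasoning
    ends-of : ∀ e → count (λ v → M? e ×-dec incident? G v e) ≡ indicator (M? e) + indicator (M? e)
    ends-of e with M? e
    ... | yes Me = trans (count-cong (λ v → yes Me ×-dec incident? G v e) (λ v → incident? G v e) proj₂ (Me ,_))
                         (count-ends e)
    ... | no ¬Me = count-∅ (λ v → no ¬Me ×-dec incident? G v e) (λ v → ¬Me ∘ proj₁)

  adjacent-sym : ∀ {e f} → Adjacent G e f → Adjacent G f e
  adjacent-sym (e≢f , v , ev , fv) = e≢f ∘ sym , v , fv , ev

  Matching : Pred (Fin (m G)) ℓ → Set ℓ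
  Matching M = ∀ {e f} → M e → M f → ¬ Adjacent G e f

  colour-class-matching : ∀ {M : Pred (Fin (m G)) ℓ} (c : Fin (m G) → Fin k) →
                          (∀ {e f} → M e → M f → Adjacent G e f → c e ≢ c f) →
                          ∀ d → Matching (λ e → M e × c e ≡ d)
  colour-class-matching c proper d (Me , ce≡d) (Mf , cf≡d) adj = proper Me Mf adj (trans ce≡d (sym cf≡d))

  Covered : Pred (Fin (m G)) ℓ → Pred (Fin (n G)) ℓ
  Covered M v = ∃ λ e → M e × Incident G e v

  covered? : {M : Pred (Fin (m G)) ℓ} → Decidable M → Decidable (Covered M)
  covered? M? v = any? (λ e → M? e ×-dec incident? G v e)

  matching-bound : {M : Pred (Fin (m G)) ℓ} (M? : Decidable M) → Matching M →
                   (W : Subset (n G)) → (∀ {e v} → M e → Incident G e v → v ∈ W) →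
                   count M? + count M? + count (λ v → (v ∈? W) ×-dec ¬? (covered? M? v)) ≤ ∣ W ∣
  matching-bound {M = M} M? matching W inside = begin
    count M? + count M? + count uncovered?                ≡⟨ cong (_+ count uncovered?) (handshake M?) ⟨
    sum at + count uncovered?                             ≡⟨ ∑-distrib-+ at (indicator ∘ uncovered?) ⟨
    sum (λ v → at v + indicator (uncovered? v))           ≤⟨ sum-mono-≤ at-vertex ⟩
    count (_∈? W)                                         ≡⟨ ∣p∣≡count-∈ W ⟨
    ∣ W ∣                                                 ∎
    where
    open ≤-Reasoning
    uncovered? = λ v → (v ∈? W) ×-dec ¬? (covered? M? v)
    at : Fin (n G) → ℕ
    at v = count (λ e → M? e ×-dec incident? G v e)
    at≤1 : ∀ v → at v ≤ 1
    at≤1 v = count-≤1 (λ e → M? e ×-dec incident? G v e) same-edge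
      where
      same-edge : ∀ {e f} → M e × Incident G e v → M f × Incident G f v → e ≡ f
      same-edge {e} {f} (Me , ev) (Mf , fv) with e ≟ f
      ... | yes e≡f = e≡f
      ... | no e≢f  = contradiction (e≢f , v , ev , fv) (matching Me Mf)
    at≡0 : ∀ {v} → ¬ Covered M v → at v ≡ 0
    at≡0 {v} ¬cov = count-∅ (λ e → M? e ×-dec incident? G v e) (λ e Me×ev → ¬cov (e , Me×ev))
    at-vertex : ∀ v → at v + indicator (uncovered? v) ≤ indicator (v ∈? W)
    at-vertex v with v ∈? W | covered? M? v
    ... | yes _  | yes _             = ≤-trans (≤-reflexive (+-identityʳ (at v))) (at≤1 v)
    ... | yes _  | no ¬cov           = ≤-reflexive (cong (_+ 1) (at≡0 ¬cov))
    ... | no v∉W | yes (_ , Me , ev) = contradiction (inside Me ev) v∉W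
    ... | no _   | no ¬cov           = ≤-reflexive (cong (_+ 0) (at≡0 ¬cov))

  module _ {W : Subset (n G)} {t : ℕ} (odd : ∣ W ∣ ≡ 1 + 2 * t)
           {M : Pred (Fin (m G)) ℓ} (M? : Decidable M) (matching : Matching M)
           (inside : ∀ {e v} → M e → Incident G e v → v ∈ W) where

    matching≤t : count M? ≤ t
    matching≤t =
      m+m≤1+2t⇒m≤t (≤-trans (m≤m+n _ _) (≤-trans (matching-bound M? matching W inside) (≤-reflexive odd)))

    matching<t : ∀ {v w} → v ∈ W → w ∈ W → v ≢ w → ¬ Covered M v → ¬ Covered M w → count M? < t
    matching<t v∈W w∈W v≢w ¬cov-v ¬cov-w = m+m+2≤1+2t⇒m<t (begin
      count M? + count M? + 2                 ≤⟨ +-monoʳ-≤ (count M? + count M?) two-uncovered ⟩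
      count M? + count M? + count uncovered?  ≤⟨ matching-bound M? matching W inside ⟩
      ∣ W ∣                                   ≡⟨ odd ⟩
      1 + 2 * t                               ∎)
      where
      open ≤-Reasoning
      uncovered? = λ v → (v ∈? W) ×-dec ¬? (covered? M? v)
      two-uncovered : 2 ≤ count uncovered?
      two-uncovered = count≥2 uncovered? (v∈W , ¬cov-v) (w∈W , ¬cov-w) v≢w

-- Boundary edges and missed colours of a dense subgraph

module Boundary (G : Graph) (H : Subgraph G) where

  degH degO : Fin (n G) → ℕ
  degH v = count (incident? G v ∩? (_∈? EH H))
  degO v = count (incident? G v ∩? ∁? (_∈? EH H))

  deg≡degH+degO : ∀ v → deg G v ≡ degH v + degO v
  deg≡degH+degO v = trans (deg≡count G v) (count-split (incident? G v) (_∈? EH H))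

  edge∈EH⇒ends∈VH : ∀ {e v} → e ∈ EH H → Incident G e v → v ∈ VH H
  edge∈EH⇒ends∈VH {e} e∈EH (inj₁ refl) = proj₁ (closed H e e∈EH)
  edge∈EH⇒ends∈VH {e} e∈EH (inj₂ refl) = proj₂ (closed H e e∈EH)

  -- The end of a boundary edge that lies in V(H); an arbitrary end of any other edge.
  inner : Fin (m G) → Fin (n G)
  inner f with proj₁ (ends G f) ∈? VH H
  ... | yes _ = proj₁ (ends G f)
  ... | no _  = proj₂ (ends G f)

  boundary? : Decidable (InBoundary G H)
  boundary? f = ((a ∈? VH H) ×-dec ¬? (b ∈? VH H)) ⊎-dec (¬? (a ∈? VH H) ×-dec (b ∈? VH H))
    where
    a = proj₁ (ends G f)
    b = proj₂ (ends G f)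

  boundary∉EH : ∀ {f} → InBoundary G H f → f ∉ EH H
  boundary∉EH {f} (inj₁ (_ , b∉VH)) f∈EH = b∉VH (proj₂ (closed H f f∈EH))
  boundary∉EH {f} (inj₂ (a∉VH , _)) f∈EH = a∉VH (proj₁ (closed H f f∈EH))

  boundary-inner : ∀ {f} → InBoundary G H f → inner f ∈ VH H × Incident G f (inner f)
  boundary-inner {f} bd with proj₁ (ends G f) ∈? VH H | bd
  ... | yes a∈VH | _                 = a∈VH , inj₁ refl
  ... | no  _    | inj₂ (_ , b∈VH)   = b∈VH , inj₂ refl
  ... | no  a∉VH | inj₁ (a∈VH , _)   = contradiction a∈VH a∉VH

  boundary-end∈VH⇒inner : ∀ {f v} → InBoundary G H f → Incident G f v → v ∈ VH H → v ≡ inner f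
  boundary-end∈VH⇒inner {f} bd fv v∈VH with proj₁ (ends G f) ∈? VH H | bd | fv
  ... | yes _    | _               | inj₁ a≡v  = sym a≡v
  ... | yes _    | inj₁ (_ , b∉VH) | inj₂ refl = contradiction v∈VH b∉VH
  ... | yes a∈VH | inj₂ (a∉VH , _) | inj₂ _    = contradiction a∈VH a∉VH
  ... | no  a∉VH | _               | inj₁ refl = contradiction v∈VH a∉VH
  ... | no  _    | _               | inj₂ b≡v  = sym b≡v

  boundary-at≤degO : ∀ v → count (λ f → boundary? f ×-dec (inner f ≟ v)) ≤ degO v
  boundary-at≤degO v = count-mono (λ f → boundary? f ×-dec (inner f ≟ v)) (incident? G v ∩? ∁? (_∈? EH H)) at-v
    where
    at-v : ∀ {f} → InBoundary G H f × inner f ≡ v → Incident G f v × f ∉ EH H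
    at-v (bd , refl) = proj₂ (boundary-inner bd) , boundary∉EH bd

module MissedColours (G : Graph) (H : Subgraph G) {k : ℕ} (ψ : Fin (m G) → Fin k) where

  open Boundary G H

  ψ-class : Fin k → Pred (Fin (m G)) 0ℓ
  ψ-class c e = e ∈ EH H × ψ e ≡ c

  ψ-class? : ∀ c → Decidable (ψ-class c)
  ψ-class? c = (_∈? EH H) ∩? (λ e → ψ e ≟ c)

  Missed : Fin (n G) → Fin k → Set
  Missed v c = ¬ Covered G (ψ-class c) v

  missed? : ∀ v → Decidable (Missed v)
  missed? v c = ¬? (covered? G (ψ-class? c) v)

  k≤missed+degH : ∀ v → k ≤ count (missed? v) + degH v
  k≤missed+degH v = begin
    k                                                             ≡⟨ count-U colour? (λ _ → tt) ⟨
    count colour?                                                 ≡⟨ count-split colour? (missed? v) ⟩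
    count (colour? ∩? missed? v) + count (colour? ∩? ∁? (missed? v))
      ≤⟨ +-mono-≤ (count-mono (colour? ∩? missed? v) (missed? v) proj₂) used≤degH ⟩
    count (missed? v) + degH v                                    ∎
    where
    open ≤-Reasoning
    colour? : Decidable {A = Fin k} U
    colour? = U?
    H-edge-at? = λ e → incident? G v e ×-dec (e ∈? EH H)
    used : ∀ {c} → U c × ¬ Missed v c → ∃ λ e → (Incident G e v × e ∈ EH H) × ψ e ≡ c
    used {c} (_ , ¬missed) with decidable-stable (covered? G (ψ-class? c) v) ¬missed
    ... | e , (e∈EH , ψe≡c) , ev = e , (ev , e∈EH) , ψe≡c
    used≤degH : count (colour? ∩? ∁? (missed? v)) ≤ degH v
    used≤degH =
      ≤-trans (count-mono (colour? ∩? ∁? (missed? v)) (λ c → any? (λ e → H-edge-at? e ×-dec (ψ e ≟ c))) used)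
              (count-image≤ H-edge-at? ψ)

  degO≤missed : ∀ v {s x} → deg G v + s ≤ k → count (missed? v) ≤ x + s → degO v ≤ x
  degO≤missed v {s} {x} deg+s≤k missed≤x+s = +-cancelʳ-≤ (s + degH v) (degO v) x (begin
    degO v + (s + degH v)       ≡⟨ cong (degO v +_) (+-comm s (degH v)) ⟩
    degO v + (degH v + s)       ≡⟨ +-assoc (degO v) (degH v) s ⟨
    degO v + degH v + s         ≡⟨ cong (_+ s) (trans (+-comm (degO v) (degH v)) (sym (deg≡degH+degO v))) ⟩
    deg G v + s                 ≤⟨ deg+s≤k ⟩
    k                           ≤⟨ k≤missed+degH v ⟩
    count (missed? v) + degH v  ≤⟨ +-monoˡ-≤ (degH v) missed≤x+s ⟩
    x + s + degH v              ≡⟨ +-assoc x s (degH v) ⟩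
    x + (s + degH v)            ∎)
    where open ≤-Reasoning

  boundary-room : ∀ v {s x} → Δ G + s ≤ k → count (missed? v) ≤ x + s →
                  count (λ f → boundary? f ×-dec (inner f ≟ v)) ≤ x
  boundary-room v Δ+s≤k missed≤x+s =
    ≤-trans (boundary-at≤degO v) (degO≤missed v (≤-trans (+-monoˡ-≤ _ (deg≤Δ G v)) Δ+s≤k) missed≤x+s)

  room-missed : Δ G ≤ k → ∀ v → count (λ f → boundary? f ×-dec (inner f ≟ v)) ≤ count (missed? v)
  room-missed Δ≤k v =
    boundary-room v (≤-trans (≤-reflexive (+-identityʳ (Δ G))) Δ≤k) (≤-reflexive (sym (+-identityʳ _)))

module DenseSubgraph (G : Graph) (H : Subgraph G) {t : ℕ} (odd : ∣ VH H ∣ ≡ 1 + 2 * t)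
                     {k : ℕ} (size : ∣ EH H ∣ ≡ t * k) where

  open Boundary G H

  count-EH : count (_∈? EH H) ≡ t * k
  count-EH = trans (sym (∣p∣≡count-∈ (EH H))) size

  -- Otherwise the k colour classes of col, matchings inside the odd set V(H), would cover t k + 1 edges.
  inner-edge∈EH : ∀ {col} → ProperColoring G k col →
                  ∀ e → proj₁ (ends G e) ∈ VH H → proj₂ (ends G e) ∈ VH H → e ∈ EH H
  inner-edge∈EH {col} col-proper e a∈VH b∈VH with e ∈? EH H
  ... | yes e∈EH = e∈EH
  ... | no  e∉EH = contradiction (≤-trans too-many (≤-reflexive (*-comm k t))) (<-irrefl refl)
    where
    EH+e? = λ x → (x ∈? EH H) ⊎-dec (x ≟ e)
    inside : ∀ {d x v} → (x ∈ EH H ⊎ x ≡ e) × col x ≡ d → Incident G x v → v ∈ VH H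
    inside (inj₁ x∈EH , _) xv        = edge∈EH⇒ends∈VH x∈EH xv
    inside (inj₂ refl , _) (inj₁ refl) = a∈VH
    inside (inj₂ refl , _) (inj₂ refl) = b∈VH
    too-many : 1 + t * k ≤ k * t
    too-many = begin
      1 + t * k                                       ≡⟨ cong suc count-EH ⟨
      1 + count (_∈? EH H)                            ≡⟨ count-insert (_∈? EH H) e∉EH ⟨
      count EH+e?                                     ≡⟨ ∑-count-fibres EH+e? col ⟨
      sum (λ d → count (EH+e? ∩? (λ x → col x ≟ d)))
        ≤⟨ sum-≤-* _ (λ d → matching≤t G {t = t} odd (EH+e? ∩? (λ x → col x ≟ d))
                              (colour-class-matching G col (λ _ _ → col-proper _ _) d) inside) ⟩
      k * t                                           ∎
      where open ≤-Reasoning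

  leaving-edge-boundary : ∀ {col} → ProperColoring G k col →
                          ∀ {f w} → f ∉ EH H → Incident G f w → w ∈ VH H → InBoundary G H f
  leaving-edge-boundary col-proper {f} f∉EH (inj₁ refl) a∈VH with proj₂ (ends G f) ∈? VH H
  ... | yes b∈VH = contradiction (inner-edge∈EH col-proper f a∈VH b∈VH) f∉EH
  ... | no  b∉VH = inj₁ (a∈VH , b∉VH)
  leaving-edge-boundary col-proper {f} f∉EH (inj₂ refl) b∈VH with proj₁ (ends G f) ∈? VH H
  ... | yes a∈VH = contradiction (inner-edge∈EH col-proper f a∈VH b∈VH) f∉EH
  ... | no  a∉VH = inj₂ (a∉VH , b∈VH)

  meets-at-inner : ∀ {col} → ProperColoring G k col → ∀ {e f} → e ∈ EH H → f ∉ EH H → Adjacent G e f →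
                   InBoundary G H f × Incident G e (inner f)
  meets-at-inner col-proper e∈EH f∉EH (_ , w , ew , fw) =
    boundary , subst (Incident G _) (boundary-end∈VH⇒inner boundary fw w∈VH) ew
    where
    w∈VH = edge∈EH⇒ends∈VH e∈EH ew
    boundary = leaving-edge-boundary col-proper f∉EH fw w∈VH

  module _ {ψ : Fin (m G) → Fin k} (ψ-proper : ProperOnH G H k ψ) where

    open MissedColours G H ψ

    ψ-class-matching : ∀ c → Matching G (ψ-class c)
    ψ-class-matching = colour-class-matching G ψ (λ {e} {f} → ψ-proper e f)

    -- Otherwise the ψ-class of c would have fewer than t edges, and all k classes fewer than t k in total.
    missed-once : ∀ {v w c} → v ∈ VH H → w ∈ VH H → Missed v c → Missed w c → v ≡ w
    missed-once {v} {w} {c} v∈VH w∈VH missed-v missed-w with v ≟ w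
    ... | yes v≡w = v≡w
    ... | no  v≢w = contradiction (≤-trans too-few (≤-reflexive (*-comm k t))) (<-irrefl refl)
      where
      class≤t : ∀ d → count (ψ-class? d) ≤ t
      class≤t d = matching≤t G {t = t} odd (ψ-class? d) (ψ-class-matching d) (edge∈EH⇒ends∈VH ∘ proj₁)
      class<t : count (ψ-class? c) < t
      class<t = matching<t G {t = t} odd (ψ-class? c) (ψ-class-matching c) (edge∈EH⇒ends∈VH ∘ proj₁)
                           v∈VH w∈VH v≢w missed-v missed-w
      too-few : 1 + t * k ≤ k * t
      too-few = begin
        1 + t * k                            ≡⟨ cong suc count-EH ⟨
        1 + count (_∈? EH H)                 ≡⟨ cong suc (∑-count-fibres (_∈? EH H) ψ) ⟨
        1 + sum (λ d → count (ψ-class? d))   ≤⟨ sum-<-* _ class≤t c class<t ⟩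
        k * t                                ∎
        where open ≤-Reasoning

    missed-disjoint : ∀ {f f′ c} → InBoundary G H f → InBoundary G H f′ →
                      Missed (inner f) c → Missed (inner f′) c → inner f ≡ inner f′
    missed-disjoint bd bd′ = missed-once (proj₁ (boundary-inner bd)) (proj₁ (boundary-inner bd′))

-- Recolouring

module Recolouring (G : Graph) (H : Subgraph G) {k : ℕ}
                   {ψ : Fin (m G) → Fin k} (ψ-proper : ProperOnH G H k ψ)
                   {φ : Fin (m G) → Fin k} (φ-proper : ProperOffH G H k φ) where

  colouring : Permutation′ k → Fin (m G) → Fin k
  colouring π = combine G H k π ψ φ

  colouring-in : ∀ π {e} → e ∈ EH H → colouring π e ≡ π ⟨$⟩ʳ ψ e
  colouring-in π {e} e∈EH with e ∈? EH H
  ... | yes _   = refl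
  ... | no e∉EH = contradiction e∈EH e∉EH

  colouring-out : ∀ π {e} → e ∉ EH H → colouring π e ≡ φ e
  colouring-out π {e} e∉EH with e ∈? EH H
  ... | yes e∈EH = contradiction e∈EH e∉EH
  ... | no _     = refl

  Conflict : Permutation′ k → Fin (m G) → Fin (m G) → Set
  Conflict π e f = e ∈ EH H × f ∉ EH H × Adjacent G e f × π ⟨$⟩ʳ ψ e ≡ φ f

  same-colour⇒conflict : ∀ π {e f} → Adjacent G e f → colouring π e ≡ colouring π f →
                         Conflict π e f ⊎ Conflict π f e
  same-colour⇒conflict π {e} {f} adj same with e ∈? EH H | f ∈? EH H
  ... | yes e∈EH | yes f∈EH = contradiction (⟨$⟩ʳ-injective π same) (ψ-proper e f e∈EH f∈EH adj)
  ... | no  e∉EH | no  f∉EH = contradiction same (φ-proper e f e∉EH f∉EH adj)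
  ... | yes e∈EH | no  f∉EH = inj₁ (e∈EH , f∉EH , adj , same)
  ... | no  e∉EH | yes f∈EH = inj₂ (f∈EH , e∉EH , adjacent-sym G adj , sym same)

  module _ {t : ℕ} (odd : ∣ VH H ∣ ≡ 1 + 2 * t) (size : ∣ EH H ∣ ≡ t * k)
           {col : Fin (m G) → Fin k} (col-proper : ProperColoring G k col)
           (φ-boundary : ∀ e f → InBoundary G H e → InBoundary G H f → e ≢ f → φ e ≢ φ f) where

    open Boundary G H
    open MissedColours G H ψ
    open DenseSubgraph G H {t} odd size

    φ-injective-on-boundary : ∀ {f f′} → InBoundary G H f → InBoundary G H f′ → φ f ≡ φ f′ → f ≡ f′
    φ-injective-on-boundary {f} {f′} bd bd′ φf≡φf′ with f ≟ f′
    ... | yes f≡f′ = f≡f′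
    ... | no  f≢f′ = contradiction φf≡φf′ (φ-boundary f f′ bd bd′ f≢f′)

    conflict-missed : ∀ π {e f} → Conflict π e f → InBoundary G H f × ¬ Missed (inner f) (ψ e)
    conflict-missed π {e} (e∈EH , f∉EH , adj , _) =
      proj₁ meets , λ missed → missed (e , (e∈EH , refl) , proj₂ meets)
      where meets = meets-at-inner col-proper e∈EH f∉EH adj

    same-colour⇒across-boundary : ∀ π {e f} → Adjacent G e f → colouring π e ≡ colouring π f →
                                  (e ∈ EH H × InBoundary G H f) ⊎ (f ∈ EH H × InBoundary G H e)
    same-colour⇒across-boundary π adj same with same-colour⇒conflict π adj same
    ... | inj₁ conflict@(e∈EH , _) = inj₁ (e∈EH , proj₁ (conflict-missed π conflict))
    ... | inj₂ conflict@(f∈EH , _) = inj₂ (f∈EH , proj₁ (conflict-missed π conflict))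

    same-colour-pairs-equal :
      ∀ π {e f e′ f′} → e ∈ EH H → InBoundary G H f → e′ ∈ EH H → InBoundary G H f′ →
      Adjacent G e f → Adjacent G e′ f′ → colouring π e ≡ colouring π e′ → colouring π f ≡ colouring π f′ →
      e ≡ e′ × f ≡ f′
    same-colour-pairs-equal π {e} {f} {e′} e∈EH bd e′∈EH bd′ adj adj′ same-e same-f
      with φ-injective-on-boundary bd bd′
             (trans (sym (colouring-out π (boundary∉EH bd))) (trans same-f (colouring-out π (boundary∉EH bd′))))
    ... | refl with e ≟ e′
    ...   | yes e≡e′ = e≡e′ , refl
    ...   | no  e≢e′ = contradiction ψe≡ψe′
                         (ψ-proper e e′ e∈EH e′∈EH (e≢e′ , inner f , at-inner adj e∈EH , at-inner adj′ e′∈EH))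
      where
      at-inner : ∀ {x} → Adjacent G x f → x ∈ EH H → Incident G x (inner f)
      at-inner adj-x x∈EH = proj₂ (meets-at-inner col-proper x∈EH (boundary∉EH bd) adj-x)
      ψe≡ψe′ : ψ e ≡ ψ e′
      ψe≡ψe′ = ⟨$⟩ʳ-injective π (trans (sym (colouring-in π e∈EH)) (trans same-e (colouring-in π e′∈EH)))

    part-a : Δ G ≤ k → Σ[ π ∈ Permutation′ k ] ProperColoring G k (colouring π)
    part-a Δ≤k
      with π , respects , _ ← respecting-permutation missed? boundary? inner φ φ-injective-on-boundary
                                (missed-disjoint ψ-proper) (λ {f} _ → room-missed Δ≤k (inner f))
      = π , proper
      where
      no-conflict : ∀ {e f} → ¬ Conflict π e f
      no-conflict conflict@(_ , _ , _ , πψe≡φf) with conflict-missed π conflict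
      ... | bd , not-missed = not-missed (respects bd _ πψe≡φf)
      proper : ProperColoring G k (colouring π)
      proper e f adj same with same-colour⇒conflict π adj same
      ... | inj₁ conflict = no-conflict conflict
      ... | inj₂ conflict = no-conflict conflict

    module _ (i : Fin k) where

      Avoiding : Fin (n G) → Pred (Fin k) 0ℓ
      Avoiding v = Missed v ∩ ∁ (i ≡_)

      avoiding? : ∀ v → Decidable (Avoiding v)
      avoiding? v = missed? v ∩? ∁? (i ≟_)

      Recoloured : Pred (Fin (m G)) 0ℓ
      Recoloured = InBoundary G H ∩ ∁ (λ f → φ f ≡ i)

      recoloured? : Decidable Recoloured
      recoloured? = boundary? ∩? ∁? (λ f → φ f ≟ i)

      missed≤avoiding+1 : ∀ v → count (missed? v) ≤ count (avoiding? v) + 1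
      missed≤avoiding+1 v = begin
        count (missed? v)                                  ≡⟨ count-split (missed? v) (i ≟_) ⟩
        count (missed? v ∩? (i ≟_)) + count (avoiding? v)
          ≤⟨ +-monoˡ-≤ _ (count-mono (missed? v ∩? (i ≟_)) (i ≟_) proj₂) ⟩
        count (i ≟_) + count (avoiding? v)                 ≡⟨ cong (_+ count (avoiding? v)) (count-singleton i) ⟩
        1 + count (avoiding? v)                            ≡⟨ +-comm 1 _ ⟩
        count (avoiding? v) + 1                            ∎
        where open ≤-Reasoning

      room-avoiding : Δ G + 1 ≤ k → ∀ v → count (λ f → recoloured? f ×-dec (inner f ≟ v)) ≤ count (avoiding? v)
      room-avoiding Δ+1≤k v = ≤-trans
        (count-mono (λ f → recoloured? f ×-dec (inner f ≟ v)) (λ f → boundary? f ×-dec (inner f ≟ v))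
                    (map₁ proj₁))
        (boundary-room v Δ+1≤k (missed≤avoiding+1 v))

      conflict-colour : ∀ π → Respects Avoiding Recoloured inner φ π → ∀ {e f} → Conflict π e f → φ f ≡ i
      conflict-colour π respects {f = f} conflict@(_ , _ , _ , πψe≡φf) with φ f ≟ i | conflict-missed π conflict
      ... | yes φf≡i | _               = φf≡i
      ... | no  φf≢i | bd , not-missed = contradiction (proj₁ (respects (bd , φf≢i) _ πψe≡φf)) not-missed

      only-i-repeats : ∀ π → Respects Avoiding Recoloured inner φ π →
                       ∀ e f → Adjacent G e f → colouring π e ≡ colouring π f → colouring π e ≡ i
      only-i-repeats π respects e f adj same with same-colour⇒conflict π adj same
      ... | inj₁ conflict@(e∈EH , _ , _ , πψe≡φf) =
              trans (colouring-in π e∈EH) (trans πψe≡φf (conflict-colour π respects conflict))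
      ... | inj₂ conflict@(_ , e∉EH , _) = trans (colouring-out π e∉EH) (conflict-colour π respects conflict)

      -- i is neither an allowed preimage nor a target, so the construction never moves it.
      part-b : Δ G + 1 ≤ k → Σ[ π ∈ Permutation′ k ] π ⟨$⟩ʳ i ≡ i × AlmostProper G H k (colouring π) i
      part-b Δ+1≤k
        with π , respects , fixes ← respecting-permutation avoiding? recoloured? inner φ
               (λ r r′ → φ-injective-on-boundary (proj₁ r) (proj₁ r′))
               (λ r r′ A A′ → missed-disjoint ψ-proper (proj₁ r) (proj₁ r′) (proj₁ A) (proj₁ A′))
               (λ {f} _ → room-avoiding Δ+1≤k (inner f))
        = π , fixes i (λ r → (λ A → proj₂ A refl) , proj₂ r) ,
          only-i-repeats π respects ,
          (λ e f adj Ce≡i Cf≡i → same-colour⇒across-boundary π adj (trans Ce≡i (sym Cf≡i))) ,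
          (λ e f e′ f′ e∈EH bd e′∈EH bd′ adj adj′ Ce≡i Cf≡i Ce′≡i Cf′≡i →
             same-colour-pairs-equal π e∈EH bd e′∈EH bd′ adj adj′
                                     (trans Ce≡i (sym Ce′≡i)) (trans Cf≡i (sym Cf′≡i)))

dense-edge-count : ∀ {v e k t} → v ≡ 1 + 2 * t → e ≡ ((v ∸ 1) * k) / 2 → e ≡ t * k
dense-edge-count {k = k} {t} refl e≡ = begin
  _                     ≡⟨ e≡ ⟩
  ((2 * t) * k) / 2     ≡⟨ cong (_/ 2) (trans (*-assoc 2 t k) (*-comm 2 (t * k))) ⟩
  ((t * k) * 2) / 2     ≡⟨ m*n/n≡m (t * k) 2 ⟩
  t * k                 ∎
  where open ≡-Reasoning

lemma2p5 : (G : Graph) (k : ℕ) → ChromaticIndex G k →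
    (H : Subgraph G) → Dense G H k →
    (ψ : Fin (m G) → Fin k) → ProperOnH G H k ψ →
    (φ : Fin (m G) → Fin k) → ProperOffH G H k φ →
    (∀ e f → InBoundary G H e → InBoundary G H f → e ≢ f → φ e ≢ φ f) →
    ((Δ G ≤ k →
        Σ (Permutation′ k) λ π → ProperColoring G k (combine G H k π ψ φ))
     × (∀ (i : Fin k) → Δ G + 1 ≤ k →
        Σ (Permutation′ k) λ π → (π ⟨$⟩ʳ i ≡ i)
          × AlmostProper G H k (combine G H k π ψ φ) i))
lemma2p5 G k ((col , col-proper) , _) H ((t , odd) , size) ψ ψ-proper φ φ-proper φ-boundary =
  part-a {t = t} odd sizeₜ col-proper φ-boundary , λ i → part-b {t = t} odd sizeₜ col-proper φ-boundary i
  where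
  open Recolouring G H ψ-proper φ-proper
  sizeₜ = dense-edge-count {t = t} odd size
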